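{- Let $G$ be a connected graph with $n\ge 2$ vertices and $k$ an integer. The following are equivalent: (1) there is a GS ordering of $G$ whose $\mathcal{F}$-tree has at most $k$ leaves; (2) there is a $Z^*$-forcing set of $G$ of size at most $k$; (3) there is a generic $Z$-sequence of $G$ of length at least $n-k$.
   Context: All graphs are finite, simple, undirected, connected and non-empty; $N(v)$ is the open and $N[v]=N(v)\cup\{v\}$ the closed neighborhood. A GS ordering of $G$ is an ordering $(v_1,\dots,v_n)$ of all vertices in which every $v_i$ with $i>1$ is adjacent to some $v_j$ with $j<i$. The $\mathcal{F}$-tree of $\sigma=(v_1,\dots,v_n)$ is the spanning tree rooted at $v_1$ in which, for $i>1$, the parent of $v_i$ is its leftmost neighbor in $\sigma$; a leaf is a vertex with no children, and the root is never counted as a leaf. A sequence $(v_1,\dots,v_k)$ of vertices is a generic $Z$-sequence of $G$ if it is a prefix of some GS ordering of $G$ and for all $i\in[k]$ the set $N(v_i)\setminus\bigcup_{j=1}^{i-1}N[v_j]$ is non-empty. $Z^*$-rule: if $v$ is a blue vertex, $v$ has exactly one white neighbor $w$, and $w$ is either the only white vertex of $G$ or $w$ has at least one white neighbor, then $w$ may be recolored blue. A set $S\subseteq V(G)$ is a $Z^*$-forcing set if, starting with the vertices of $S$ blue and all others white, iterated applications of the $Z^*$-rule can color all vertices blue. -}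

module Defs where

open import Data.Nat using (ℕ; zero; suc; _<_; _<ᵇ_; _≤ᵇ_; _+_)
open import Data.Bool using (Bool; true; false; _∧_; _∨_; not; if_then_else_)
open import Data.Fin using (Fin; toℕ) renaming (zero to fzero; suc to fsuc)
open import Data.Fin.Subset using (Subset; _∈_; _∉_; _∪_; ⁅_⁆; ⊤)
open import Data.List using (List; length; lookup; _++_)
import Data.List.Membership.Propositional as LM
open import Data.List.Relation.Unary.Unique.Propositional using (Unique)
open import Data.Product using (_×_; ∃-syntax; Σ-syntax)
open import Data.Sum using (_⊎_)
open import Relation.Nullary using (¬_)
open import Relation.Binary.PropositionalEquality using (_≡_; _≢_)
open import Relation.Binary.Construct.Closure.ReflexiveTransitive using (Star)

record Graph (n : ℕ) : Set where
  field
    adj        : Fin n → Fin n → Bool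
    adj-sym    : ∀ u v → adj u v ≡ adj v u
    adj-irrefl : ∀ v → adj v v ≡ false
open Graph public

Adj : ∀ {n} → Graph n → Fin n → Fin n → Set
Adj G u v = adj G u v ≡ true

Connected : ∀ {n} → Graph n → Set
Connected G = ∀ u v → Star (Adj G) u v

allᵇ : ∀ {n} → (Fin n → Bool) → Bool
allᵇ {zero}  f = true
allᵇ {suc n} f = f fzero ∧ allᵇ (λ i → f (fsuc i))

countᵇ : ∀ {n} → (Fin n → Bool) → ℕ
countᵇ {zero}  f = 0
countᵇ {suc n} f = (if f fzero then 1 else 0) + countᵇ (λ i → f (fsuc i))

IsGSOrdering : ∀ {n} → Graph n → List (Fin n) → Set
IsGSOrdering G σ =
  Unique σ × (∀ v → v LM.∈ σ) ×
  (∀ (i : Fin (length σ)) → 0 < toℕ i →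
     ∃[ j ] (toℕ j < toℕ i × Adj G (lookup σ i) (lookup σ j)))

-- In the F-tree of σ, position i is the parent of position j iff j is not
-- the root (j > 0) and σ_i is the leftmost neighbour of σ_j in σ.
isParentᵇ : ∀ {n} → Graph n → (σ : List (Fin n)) → Fin (length σ) → Fin (length σ) → Bool
isParentᵇ G σ i j =
  (0 <ᵇ toℕ j) ∧ adj G (lookup σ i) (lookup σ j) ∧
  allᵇ (λ k → (toℕ i ≤ᵇ toℕ k) ∨ not (adj G (lookup σ k) (lookup σ j)))

isLeafᵇ : ∀ {n} → Graph n → (σ : List (Fin n)) → Fin (length σ) → Bool
isLeafᵇ G σ i = (0 <ᵇ toℕ i) ∧ allᵇ (λ j → not (isParentᵇ G σ i j))

numLeaves : ∀ {n} → Graph n → List (Fin n) → ℕ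
numLeaves G σ = countᵇ (isLeafᵇ G σ)

ZStarStep : ∀ {n} → Graph n → Subset n → Subset n → Set
ZStarStep G B B' =
  ∃[ v ] ∃[ w ]
    (v ∈ B × w ∉ B × Adj G v w ×
     (∀ u → Adj G v u → u ∉ B → u ≡ w) ×
     ((∀ u → u ∉ B → u ≡ w) ⊎ (∃[ u ] (u ∉ B × Adj G w u))) ×
     B' ≡ B ∪ ⁅ w ⁆)

IsZStarForcingSet : ∀ {n} → Graph n → Subset n → Set
IsZStarForcingSet G S = Star (ZStarStep G) S ⊤

IsGenericZSeq : ∀ {n} → Graph n → List (Fin n) → Set
IsGenericZSeq G vs =
  (∃[ σ ] (IsGSOrdering G σ × ∃[ ρ ] (vs ++ ρ ≡ σ))) ×
  (∀ (i : Fin (length vs)) →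
     ∃[ w ] (Adj G (lookup vs i) w ×
       (∀ (j : Fin (length vs)) → toℕ j < toℕ i →
          (w ≢ lookup vs j) × ¬ Adj G (lookup vs j) w)))

module Submission where

-- (1 ⇒ 2) In the F-tree of a GS ordering σ, colour the leaves blue and then the remaining positions from right
-- to left: a non-leaf is the leftmost neighbour of each of its children, so such a child, all of whose
-- other neighbours lie further left and are already blue, forces it.
-- (2 ⇒ 3) Read backwards, a Z*-forcing process lists the vertices outside the forcing set so that each has a
-- private neighbour (the vertex that forced it) and, by the Z*-rule, is adjacent to a later-forced vertex; by
-- connectivity this list extends to a GS ordering.
-- (3 ⇒ 1) In a GS ordering extending a generic Z-sequence, each entry is the leftmost neighbour of its private
-- neighbour, hence not a leaf.

open import Defs
open import Data.Bool using (Bool; true; false; _∨_)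
import Data.Bool.Properties as Boolₚ
open import Data.Empty using (⊥-elim)
open import Data.Fin using (Fin; toℕ; fromℕ<) renaming (zero to fzero; suc to fsuc)
import Data.Fin.Properties as Finₚ
open import Data.Fin.Subset using (Subset; _∈_; _∉_; _⊆_; _∪_; ⁅_⁆; ⊤; ⊥; ∣_∣)
import Data.Fin.Subset.Properties as Subsetₚ
open import Data.Integer as ℤ using (ℤ; +_; _-_; +≤+) renaming (_≤_ to _≤ℤ_)
import Data.Integer.Properties as ℤₚ
open import Data.Integer.Solver using (module +-*-Solver)
open import Data.List using (List; []; _∷_; length; lookup; _++_; [_])
import Data.List.Properties as Listₚ
open import Data.List.Membership.Propositional using () renaming (_∈_ to _∈ₗ_; _∉_ to _∉ₗ_)
import Data.List.Membership.Propositional.Properties as Membershipₚ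
open import Data.List.Relation.Unary.All as All using (All)
open import Data.List.Relation.Unary.Any as Any using (Any; here)
import Data.List.Relation.Unary.All.Properties as Allₚ
import Data.List.Relation.Unary.Any.Properties as Anyₚ
open import Data.List.Relation.Unary.Unique.Propositional using (Unique; []; _∷_)
import Data.List.Relation.Unary.Unique.Propositional.Properties as Uniqueₚ
open import Data.Nat as ℕ using (ℕ; zero; suc; _+_; _≤_; _<_; z≤n; s≤s; _≤?_)
import Data.Nat.Properties as ℕₚ
open import Data.Product using (_×_; _,_; proj₁; proj₂; ∃-syntax)
open import Data.Vec using ([]; _∷_)
open import Data.Sum using (_⊎_; inj₁; inj₂)
open import Function using (_∘_)
open import Level using (0ℓ)
open import Function.Bundles using (_⇔_; mk⇔)
open import Relation.Binary.Construct.Closure.ReflexiveTransitive using (Star; ε; _◅_)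
open import Relation.Binary.PropositionalEquality hiding ([_])
open import Relation.Nullary using (¬_; Dec; yes; no; _because_; does; proof; ¬?)
open import Relation.Nullary.Decidable using (dec-false; decidable-stable; _⊎-dec_)
open import Relation.Nullary.Reflects using (Reflects; ofʸ; ofⁿ; _×-reflects_; _⊎-reflects_; ¬-reflects)
open import Relation.Unary using (Pred; Decidable)

module _ where
  open +-*-Solver

  i≤k+j⇒i-k≤j : ∀ i j k → i ≤ℤ k ℤ.+ j → i - k ≤ℤ j
  i≤k+j⇒i-k≤j i j k h = subst (i - k ≤ℤ_) (solve 2 (λ j k → k :+ j :- k := j) refl j k) (ℤₚ.+-monoˡ-≤ (ℤ.- k) h)

  i-k≤j⇒i≤k+j : ∀ i j k → i - k ≤ℤ j → i ≤ℤ k ℤ.+ j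
  i-k≤j⇒i≤k+j i j k h = subst (_≤ℤ k ℤ.+ j) (solve 2 (λ i k → k :+ (i :- k) := i) refl i k) (ℤₚ.+-monoʳ-≤ k h)

  +-cancelʳ-≤ : ∀ i j k → i ℤ.+ j ≤ℤ k ℤ.+ j → i ≤ℤ k
  +-cancelʳ-≤ i j k h = subst₂ _≤ℤ_ (cancel i j) (cancel k j) (ℤₚ.+-monoˡ-≤ (ℤ.- j) h)
    where
    cancel : ∀ x j → x ℤ.+ j - j ≡ x
    cancel = solve 2 (λ x j → x :+ j :- j := x) refl

lookup-injective : ∀ {A : Set} {xs : List A} → Unique xs → ∀ {i j} → lookup xs i ≡ lookup xs j → i ≡ j
lookup-injective (x∉xs ∷ _) {fzero} {fzero} _ = refl
lookup-injective (x∉xs ∷ _) {fzero} {fsuc j} eq = ⊥-elim (All.lookup x∉xs (Membershipₚ.∈-lookup j) eq)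
lookup-injective (x∉xs ∷ _) {fsuc i} {fzero} eq = ⊥-elim (All.lookup x∉xs (Membershipₚ.∈-lookup i) (sym eq))
lookup-injective (_ ∷ u) {fsuc i} {fsuc j} eq = cong fsuc (lookup-injective u eq)

Unique⇒length≤ : ∀ {n} {xs : List (Fin n)} → Unique xs → length xs ≤ n
Unique⇒length≤ u = Finₚ.injective⇒≤ (lookup-injective u)

∈⇒lookup : ∀ {A : Set} {v : A} {xs : List A} → v ∈ₗ xs → ∃[ i ] (lookup xs i ≡ v)
∈⇒lookup v∈xs = Any.index v∈xs , sym (Anyₚ.lookup-index v∈xs)

covering⇒n≤length : ∀ {n} {xs : List (Fin n)} → (∀ v → v ∈ₗ xs) → n ≤ length xs
covering⇒n≤length {xs = xs} covers = Finₚ.injective⇒≤ {f = Any.index ∘ covers} λ {u} {v} same-index →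
  trans (Anyₚ.lookup-index (covers u)) (trans (cong (lookup xs) same-index) (sym (Anyₚ.lookup-index (covers v))))

length-snoc : ∀ {A : Set} (xs : List A) x → length (xs ++ [ x ]) ≡ suc (length xs)
length-snoc xs x = trans (Listₚ.length-++ xs) (ℕₚ.+-comm (length xs) 1)

Unique-snoc : ∀ {A : Set} {xs : List A} {x} → Unique xs → x ∉ₗ xs → Unique (xs ++ [ x ])
Unique-snoc u x∉xs = Uniqueₚ.++⁺ u (All.[] ∷ []) λ { (x∈xs , here refl) → x∉xs x∈xs }

inject++ : ∀ {A : Set} (xs ys : List A) → Fin (length xs) → Fin (length (xs ++ ys))
inject++ (x ∷ xs) ys fzero = fzero
inject++ (x ∷ xs) ys (fsuc i) = fsuc (inject++ xs ys i)

toℕ-inject++ : ∀ {A : Set} (xs ys : List A) i → toℕ (inject++ xs ys i) ≡ toℕ i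
toℕ-inject++ (x ∷ xs) ys fzero = refl
toℕ-inject++ (x ∷ xs) ys (fsuc i) = cong suc (toℕ-inject++ xs ys i)

lookup-inject++ : ∀ {A : Set} (xs ys : List A) i → lookup (xs ++ ys) (inject++ xs ys i) ≡ lookup xs i
lookup-inject++ (x ∷ xs) ys fzero = refl
lookup-inject++ (x ∷ xs) ys (fsuc i) = lookup-inject++ xs ys i

inject++-or-≥ : ∀ {A : Set} (xs ys : List A) c → (∃[ i ] (inject++ xs ys i ≡ c)) ⊎ length xs ≤ toℕ c
inject++-or-≥ [] ys c = inj₂ z≤n
inject++-or-≥ (x ∷ xs) ys fzero = inj₁ (fzero , refl)
inject++-or-≥ (x ∷ xs) ys (fsuc c) with inject++-or-≥ xs ys c
... | inj₁ (i , refl) = inj₁ (fsuc i , refl)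
... | inj₂ xs≤c = inj₂ (s≤s xs≤c)

lookup-snoc-≥ : ∀ {A : Set} (xs : List A) w c → length xs ≤ toℕ c →
  toℕ c ≡ length xs × lookup (xs ++ [ w ]) c ≡ w
lookup-snoc-≥ [] w fzero _ = refl , refl
lookup-snoc-≥ (x ∷ xs) w (fsuc c) (s≤s xs≤c) with lookup-snoc-≥ xs w c xs≤c
... | c≡xs , eq = cong suc c≡xs , eq

inject++-< : ∀ {A : Set} (xs ys : List A) c → toℕ c < length xs → ∃[ i ] (inject++ xs ys i ≡ c)
inject++-< xs ys c c<xs with inject++-or-≥ xs ys c
... | inj₁ c≡ = c≡
... | inj₂ xs≤c = ⊥-elim (ℕₚ.<⇒≱ c<xs xs≤c)

least : ∀ {m} {P : Pred (Fin m) 0ℓ} → Decidable P → ∃[ i ] P i → ∃[ r ] (P r × (∀ k → toℕ r ≤ toℕ k ⊎ ¬ P k))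
least {m} {P} P? (i , pᵢ) with r , ¬¬pᵣ , below-r ← Finₚ.¬∀⟶∃¬-smallest m (¬_ ∘ P) (¬? ∘ P?) (λ ¬P → ¬P i pᵢ) =
  r , decidable-stable (P? r) ¬¬pᵣ , r≤-or-¬P
  where
  r≤-or-¬P : ∀ k → toℕ r ≤ toℕ k ⊎ ¬ P k
  r≤-or-¬P k with toℕ r ≤? toℕ k
  ... | yes r≤k = inj₁ r≤k
  ... | no r≰k = inj₂ (subst (¬_ ∘ P) (Finₚ.toℕ-injective (trans (Finₚ.toℕ-inject j) (Finₚ.toℕ-fromℕ< k<r))) (below-r j))
    where
    k<r = ℕₚ.≰⇒> r≰k
    j = fromℕ< k<r

countᵇ≤ : ∀ {m} (f : Fin m → Bool) → countᵇ f ≤ m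
countᵇ≤ {zero} f = z≤n
countᵇ≤ {suc m} f with f fzero
... | true = s≤s (countᵇ≤ (f ∘ fsuc))
... | false = ℕₚ.m≤n⇒m≤1+n (countᵇ≤ (f ∘ fsuc))

countᵇ-mono : ∀ {m} (f g : Fin m → Bool) → (∀ i → f i ≡ true → g i ≡ true) → countᵇ f ≤ countᵇ g
countᵇ-mono {zero} f g f⇒g = z≤n
countᵇ-mono {suc m} f g f⇒g with f fzero in f0 | g fzero in g0
... | true | true = s≤s (countᵇ-mono (f ∘ fsuc) (g ∘ fsuc) (f⇒g ∘ fsuc))
... | true | false with () ← trans (sym (f⇒g fzero f0)) g0
... | false | true = ℕₚ.m≤n⇒m≤1+n (countᵇ-mono (f ∘ fsuc) (g ∘ fsuc) (f⇒g ∘ fsuc))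
... | false | false = countᵇ-mono (f ∘ fsuc) (g ∘ fsuc) (f⇒g ∘ fsuc)

countᵇ+k≤ : ∀ {m} (f : Fin m → Bool) k → k ≤ m → (∀ i → toℕ i < k → f i ≡ false) → countᵇ f + k ≤ m
countᵇ+k≤ f zero _ _ = subst (_≤ _) (sym (ℕₚ.+-identityʳ _)) (countᵇ≤ f)
countᵇ+k≤ {suc m} f (suc k) (s≤s k≤m) f<k≡false rewrite f<k≡false fzero (s≤s z≤n) =
  subst (_≤ suc m) (sym (ℕₚ.+-suc _ k))
    (s≤s (countᵇ+k≤ (f ∘ fsuc) k k≤m (λ i i<k → f<k≡false (fsuc i) (s≤s i<k))))

≡true-reflects : ∀ b → Reflects (b ≡ true) b
≡true-reflects true = ofʸ refl
≡true-reflects false = ofⁿ λ ()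

allᵇ-reflects : ∀ {m} {P : Fin m → Set} {f : Fin m → Bool} → (∀ i → Reflects (P i) (f i)) → Reflects (∀ i → P i) (allᵇ f)
allᵇ-reflects {zero} r = ofʸ λ ()
allᵇ-reflects {suc m} {P} {f} r with f fzero | r fzero | allᵇ (f ∘ fsuc) | allᵇ-reflects {P = P ∘ fsuc} (r ∘ fsuc)
... | true | ofʸ p₀ | true | ofʸ p₊ = ofʸ λ { fzero → p₀ ; (fsuc i) → p₊ i }
... | true | ofʸ p₀ | false | ofⁿ ¬p₊ = ofⁿ λ p → ¬p₊ (p ∘ fsuc)
... | false | ofⁿ ¬p₀ | _ | _ = ofⁿ λ p → ¬p₀ (p fzero)

∣p∪q∣≤∣p∣+∣q∣ : ∀ {n} (p q : Subset n) → ∣ p ∪ q ∣ ≤ ∣ p ∣ + ∣ q ∣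
∣p∪q∣≤∣p∣+∣q∣ [] [] = z≤n
∣p∪q∣≤∣p∣+∣q∣ (true ∷ p) (true ∷ q) = s≤s (ℕₚ.≤-trans (∣p∪q∣≤∣p∣+∣q∣ p q) (ℕₚ.+-monoʳ-≤ ∣ p ∣ (ℕₚ.n≤1+n _)))
∣p∪q∣≤∣p∣+∣q∣ (true ∷ p) (false ∷ q) = s≤s (∣p∪q∣≤∣p∣+∣q∣ p q)
∣p∪q∣≤∣p∣+∣q∣ (false ∷ p) (true ∷ q) rewrite ℕₚ.+-suc ∣ p ∣ ∣ q ∣ = s≤s (∣p∪q∣≤∣p∣+∣q∣ p q)
∣p∪q∣≤∣p∣+∣q∣ (false ∷ p) (false ∷ q) = ∣p∪q∣≤∣p∣+∣q∣ p q

image : ∀ {m n} {P : Pred (Fin m) 0ℓ} → Decidable P → (Fin m → Fin n) → Subset n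
image {zero} P? g = ⊥
image {suc m} P? g with P? fzero
... | yes _ = ⁅ g fzero ⁆ ∪ image (P? ∘ fsuc) (g ∘ fsuc)
... | no _ = image (P? ∘ fsuc) (g ∘ fsuc)

module _ {n : ℕ} where

  ∈-image⁺ : ∀ {m} {P : Pred (Fin m) 0ℓ} (P? : Decidable P) (g : Fin m → Fin n) {i} → P i → g i ∈ image P? g
  ∈-image⁺ {suc m} P? g {fzero} p with P? fzero
  ... | yes _ = Subsetₚ.x∈p∪q⁺ (inj₁ (Subsetₚ.x∈⁅x⁆ (g fzero)))
  ... | no ¬p = ⊥-elim (¬p p)
  ∈-image⁺ {suc m} P? g {fsuc i} p with P? fzero
  ... | yes _ = Subsetₚ.x∈p∪q⁺ (inj₂ (∈-image⁺ (P? ∘ fsuc) (g ∘ fsuc) p))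
  ... | no _ = ∈-image⁺ (P? ∘ fsuc) (g ∘ fsuc) p

  ∈-image⁻ : ∀ {m} {P : Pred (Fin m) 0ℓ} (P? : Decidable P) (g : Fin m → Fin n) {v} →
    v ∈ image P? g → ∃[ i ] (P i × g i ≡ v)
  ∈-image⁻ {zero} P? g v∈ = ⊥-elim (Subsetₚ.∉⊥ v∈)
  ∈-image⁻ {suc m} P? g v∈ with P? fzero
  ... | no _ with i , p , eq ← ∈-image⁻ (P? ∘ fsuc) (g ∘ fsuc) v∈ = fsuc i , p , eq
  ... | yes p₀ with Subsetₚ.x∈p∪q⁻ ⁅ g fzero ⁆ _ v∈
  ...   | inj₁ v∈⁅g₀⁆ = fzero , p₀ , sym (Subsetₚ.x∈⁅y⁆⇒x≡y _ v∈⁅g₀⁆)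
  ...   | inj₂ v∈rest with i , p , eq ← ∈-image⁻ (P? ∘ fsuc) (g ∘ fsuc) v∈rest = fsuc i , p , eq

  ∣image∣≤countᵇ : ∀ {m} {P : Pred (Fin m) 0ℓ} (P? : Decidable P) (g : Fin m → Fin n) →
    ∣ image P? g ∣ ≤ countᵇ (does ∘ P?)
  ∣image∣≤countᵇ {zero} P? g = ℕₚ.≤-reflexive (Subsetₚ.∣⊥∣≡0 n)
  ∣image∣≤countᵇ {suc m} P? g with P? fzero
  ... | yes _ = begin
    ∣ ⁅ g fzero ⁆ ∪ image′ ∣    ≤⟨ ∣p∪q∣≤∣p∣+∣q∣ ⁅ g fzero ⁆ image′ ⟩
    (∣ ⁅ g fzero ⁆ ∣ + ∣ image′ ∣) ≡⟨ cong (λ k → k + ∣ image′ ∣) (Subsetₚ.∣⁅x⁆∣≡1 (g fzero)) ⟩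
    suc ∣ image′ ∣             ≤⟨ s≤s (∣image∣≤countᵇ (P? ∘ fsuc) (g ∘ fsuc)) ⟩
    suc (countᵇ (does ∘ P? ∘ fsuc)) ∎
    where
    open ℕₚ.≤-Reasoning
    image′ = image (P? ∘ fsuc) (g ∘ fsuc)
  ... | no _ = ∣image∣≤countᵇ (P? ∘ fsuc) (g ∘ fsuc)

  image-⊆ : ∀ {m} {P Q : Pred (Fin m) 0ℓ} (P? : Decidable P) (Q? : Decidable Q) (g : Fin m → Fin n) →
    (∀ {i} → P i → Q i) → image P? g ⊆ image Q? g
  image-⊆ P? Q? g P⇒Q v∈ with i , pᵢ , refl ← ∈-image⁻ P? g v∈ = ∈-image⁺ Q? g (P⇒Q pᵢ)

Star-exit : ∀ {A : Set} {R : A → A → Set} {P : Pred A 0ℓ} → Decidable P →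
  ∀ {a b} → Star R a b → P a → ¬ P b → ∃[ x ] ∃[ y ] (R x y × P x × ¬ P y)
Star-exit P? ε pa ¬pb = ⊥-elim (¬pb pa)
Star-exit P? (_◅_ {j = y} r rs) pa ¬pb with P? y
... | yes py = Star-exit P? rs py ¬pb
... | no ¬py = _ , y , r , pa , ¬py

module _ {n : ℕ} (G : Graph n) where

  open import Data.List.Membership.DecPropositional (Finₚ._≟_ {n}) using (_∈?_)

  AdjacentToEarlier : List (Fin n) → Set
  AdjacentToEarlier xs = ∀ (i : Fin (length xs)) → 0 < toℕ i →
    ∃[ j ] (toℕ j < toℕ i × Adj G (lookup xs i) (lookup xs j))

  PrivateNeighbours : List (Fin n) → Set
  PrivateNeighbours xs = ∀ (i : Fin (length xs)) →
    ∃[ w ] (Adj G (lookup xs i) w ×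
      (∀ (j : Fin (length xs)) → toℕ j < toℕ i → (w ≢ lookup xs j) × ¬ Adj G (lookup xs j) w))

  AdjacentToEarlier-snoc : ∀ {xs u} → AdjacentToEarlier xs → (0 < length xs → Any (Adj G u) xs) →
    AdjacentToEarlier (xs ++ [ u ])
  AdjacentToEarlier-snoc {xs} {u} adj new c 0<c with inject++-or-≥ xs [ u ] c
  ... | inj₁ (i , refl) with j , j<i , a ← adj i (subst (0 <_) (toℕ-inject++ xs _ i) 0<c) =
    inject++ xs _ j ,
    subst₂ _<_ (sym (toℕ-inject++ xs _ j)) (sym (toℕ-inject++ xs _ i)) j<i ,
    subst₂ (Adj G) (sym (lookup-inject++ xs _ i)) (sym (lookup-inject++ xs _ j)) a
  ... | inj₂ xs≤c with c≡xs , c↦u ← lookup-snoc-≥ xs u c xs≤c =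
    inject++ xs _ j ,
    subst₂ _<_ (sym (toℕ-inject++ xs _ j)) (sym c≡xs) (Finₚ.toℕ<n j) ,
    subst₂ (Adj G) (sym c↦u) (sym (lookup-inject++ xs _ j)) (Anyₚ.lookup-index u~)
    where
    u~ = new (subst (0 <_) c≡xs 0<c)
    j = Any.index u~

  PrivateNeighbours-snoc : ∀ {xs u w} → PrivateNeighbours xs → Adj G u w →
    All (λ x → w ≢ x × ¬ Adj G x w) xs → PrivateNeighbours (xs ++ [ u ])
  PrivateNeighbours-snoc {xs} {u} {w} priv u~w w-private c with inject++-or-≥ xs [ u ] c
  ... | inj₁ (i , refl) with x , i~x , x-private ← priv i =
    x , subst (λ y → Adj G y x) (sym (lookup-inject++ xs _ i)) i~x , λ j j<c → private-at j j<c
    where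
    private-at : ∀ j → toℕ j < toℕ (inject++ xs [ u ] i) →
      (x ≢ lookup (xs ++ [ u ]) j) × ¬ Adj G (lookup (xs ++ [ u ]) j) x
    private-at j j<c with j′ , refl ← inject++-< xs _ j (ℕₚ.<-trans (subst (_ <_) (toℕ-inject++ xs _ i) j<c) (Finₚ.toℕ<n i))
      rewrite lookup-inject++ xs [ u ] j′ = x-private j′ (subst₂ _<_ (toℕ-inject++ xs _ j′) (toℕ-inject++ xs _ i) j<c)
  ... | inj₂ xs≤c with c≡xs , c↦u ← lookup-snoc-≥ xs u c xs≤c =
    w , subst (λ y → Adj G y w) (sym c↦u) u~w , private-at
    where
    private-at : ∀ j → toℕ j < toℕ c → (w ≢ lookup (xs ++ [ u ]) j) × ¬ Adj G (lookup (xs ++ [ u ]) j) w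
    private-at j j<c with j′ , refl ← inject++-< xs _ j (subst (_ <_) c≡xs j<c)
      rewrite lookup-inject++ xs [ u ] j′ = All.lookup w-private (Membershipₚ.∈-lookup j′)

  GSOrderingExtending : List (Fin n) → Set
  GSOrderingExtending xs = ∃[ σ ] (IsGSOrdering G σ × ∃[ ρ ] (xs ++ ρ ≡ σ))

  GSOrderingExtending-++⁻ : ∀ xs ys → GSOrderingExtending (xs ++ ys) → GSOrderingExtending xs
  GSOrderingExtending-++⁻ xs ys (σ , σ-GS , ρ , xs+ys+ρ≡σ) = σ , σ-GS , ys ++ ρ , trans (sym (Listₚ.++-assoc xs ys ρ)) xs+ys+ρ≡σ

  -- Append a vertex outside xs adjacent to xs (one exists on any path leaving xs) until xs is exhausted.
  extendToGSOrdering : Connected G → ∀ {xs a} → Unique xs → AdjacentToEarlier xs → a ∈ₗ xs → GSOrderingExtending xs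
  extendToGSOrdering conn {xs} = extend n (ℕₚ.m≤n+m n (length xs))
    where
    extend : ∀ fuel {xs a} → n ≤ length xs + fuel → Unique xs → AdjacentToEarlier xs → a ∈ₗ xs → GSOrderingExtending xs
    extend fuel {xs} bound u adj a∈xs with Finₚ.all? (_∈? xs)
    ... | yes covers = xs , (u , covers , adj) , [] , Listₚ.++-identityʳ xs
    ... | no ¬covers with b , b∉xs ← Finₚ.¬∀⟶∃¬ n _ (_∈? xs) ¬covers with fuel
    ...   | zero = ⊥-elim (ℕₚ.<⇒≱ (Unique⇒length≤ (All.tabulate (λ { x∈xs refl → b∉xs x∈xs }) ∷ u))
                                    (subst (n ≤_) (ℕₚ.+-identityʳ _) bound))
    ...   | suc fuel′ with x , y , x~y , x∈xs , y∉xs ← Star-exit (_∈? xs) (conn _ b) a∈xs b∉xs =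
      GSOrderingExtending-++⁻ xs [ y ]
        (extend fuel′ bound′ (Unique-snoc u y∉xs) adj′ (Membershipₚ.∈-++⁺ˡ a∈xs))
      where
      bound′ : n ≤ length (xs ++ [ y ]) + fuel′
      bound′ = subst (n ≤_) (trans (ℕₚ.+-suc (length xs) fuel′) (cong (_+ fuel′) (sym (length-snoc xs y)))) bound
      adj′ : AdjacentToEarlier (xs ++ [ y ])
      adj′ = AdjacentToEarlier-snoc adj λ _ → Any.map (λ { refl → trans (adj-sym G y x) x~y }) x∈xs

  module FTree (σ : List (Fin n)) where

    Position : Set
    Position = Fin (length σ)

    -- Shaped like isParentᵇ, so that isParentᵇ decides it by reflection.
    IsParent : Position → Position → Set
    IsParent i j = 0 < toℕ j × Adj G (lookup σ i) (lookup σ j) ×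
      (∀ k → toℕ i ≤ toℕ k ⊎ ¬ Adj G (lookup σ k) (lookup σ j))

    isParent? : ∀ i j → Dec (IsParent i j)
    isParent? i j = isParentᵇ G σ i j because
      (ℕₚ.<ᵇ-reflects-< 0 (toℕ j) ×-reflects ≡true-reflects _ ×-reflects
       allᵇ-reflects (λ k → ℕₚ.≤ᵇ-reflects-≤ (toℕ i) (toℕ k) ⊎-reflects ¬-reflects (≡true-reflects _)))

    IsLeaf : Position → Set
    IsLeaf i = 0 < toℕ i × (∀ j → ¬ IsParent i j)

    isLeaf? : ∀ i → Dec (IsLeaf i)
    isLeaf? i = isLeafᵇ G σ i because
      (ℕₚ.<ᵇ-reflects-< 0 (toℕ i) ×-reflects allᵇ-reflects (λ j → ¬-reflects (proof (isParent? i j))))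

    module _ (σ-earlier : AdjacentToEarlier σ) where

      parent-exists : ∀ t → 0 < toℕ t → ∃[ r ] IsParent r t
      parent-exists t 0<t with j , _ , t~j ← σ-earlier t 0<t
        with r , r~t , r-leftmost ← least (λ k → adj G (lookup σ k) (lookup σ t) Boolₚ.≟ true) (j , trans (adj-sym G _ _) t~j)
        = r , 0<t , r~t , r-leftmost

      parent<child : ∀ {r t} → IsParent r t → toℕ r < toℕ t
      parent<child {r} {t} (0<t , _ , r-leftmost) with j , j<t , t~j ← σ-earlier t 0<t with r-leftmost j
      ... | inj₁ r≤j = ℕₚ.≤-<-trans r≤j j<t
      ... | inj₂ ¬j~t = ⊥-elim (¬j~t (trans (adj-sym G _ _) t~j))

      root-parent-of-second : (2≤σ : 2 ≤ length σ) → ∀ c → toℕ c ≡ 0 → IsParent c (fromℕ< 2≤σ)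
      root-parent-of-second 2≤σ c c≡0 = subst (λ p → IsParent p (fromℕ< 2≤σ)) r≡c r-parent
        where
        parent = parent-exists (fromℕ< 2≤σ) (subst (0 <_) (sym (Finₚ.toℕ-fromℕ< 2≤σ)) (s≤s z≤n))
        r = proj₁ parent
        r-parent = proj₂ parent
        r≡c : r ≡ c
        r≡c = Finₚ.toℕ-injective
          (trans (ℕₚ.n<1⇒n≡0 (subst (toℕ r <_) (Finₚ.toℕ-fromℕ< 2≤σ) (parent<child r-parent))) (sym c≡0))

      nonLeaf⇒child : 2 ≤ length σ → ∀ c → ¬ IsLeaf c → ∃[ ch ] IsParent c ch
      nonLeaf⇒child 2≤σ c ¬leaf with 0 ℕ.<? toℕ c
      ... | yes 0<c with ch , ¬¬parent ← Finₚ.¬∀⟶∃¬ _ _ (¬? ∘ isParent? c) (λ childless → ¬leaf (0<c , childless)) =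
        ch , decidable-stable (isParent? c ch) ¬¬parent
      ... | no c≮0 = fromℕ< 2≤σ , root-parent-of-second 2≤σ c (ℕₚ.n≤0⇒n≡0 (ℕₚ.≮⇒≥ c≮0))

  module ForcingSetFromOrdering {σ} (σ-GS : IsGSOrdering G σ) (2≤n : 2 ≤ n) where

    open FTree σ

    σ-covers : ∀ v → v ∈ₗ σ
    σ-covers = proj₁ (proj₂ σ-GS)

    2≤σ : 2 ≤ length σ
    2≤σ = ℕₚ.≤-trans 2≤n (covering⇒n≤length σ-covers)

    -- Lowering p one step at a time is a Z*-forcing process from Blue (length σ) to Blue 0 = ⊤.
    IsBlue : ℕ → Position → Set
    IsBlue p i = IsLeaf i ⊎ p ≤ toℕ i

    Blue : ℕ → Subset n
    Blue p = image (λ i → isLeaf? i ⊎-dec p ≤? toℕ i) (lookup σ)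

    ∈Blue : ∀ {p i} → IsBlue p i → lookup σ i ∈ Blue p
    ∈Blue = ∈-image⁺ _ (lookup σ)

    ∉Blue : ∀ {p i} → ¬ IsBlue p i → lookup σ i ∉ Blue p
    ∉Blue ¬blue σᵢ∈ with j , blue-j , σⱼ≡σᵢ ← ∈-image⁻ _ (lookup σ) σᵢ∈
      rewrite lookup-injective (proj₁ σ-GS) σⱼ≡σᵢ = ¬blue blue-j

    white-position : ∀ {p v} → v ∉ Blue p → ∃[ i ] (lookup σ i ≡ v × ¬ IsLeaf i × toℕ i < p)
    white-position {p} {v} v∉ with i , σᵢ≡v ← ∈⇒lookup (σ-covers v) =
      i , σᵢ≡v , (λ leaf → v∉ (subst (_∈ Blue p) σᵢ≡v (∈Blue (inj₁ leaf)))) ,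
      ℕₚ.≰⇒> (λ p≤i → v∉ (subst (_∈ Blue p) σᵢ≡v (∈Blue (inj₂ p≤i))))

    IsBlue-suc⇒IsBlue : ∀ {q i} → IsBlue (suc q) i → IsBlue q i
    IsBlue-suc⇒IsBlue (inj₁ leaf) = inj₁ leaf
    IsBlue-suc⇒IsBlue (inj₂ q<i) = inj₂ (ℕₚ.<⇒≤ q<i)

    IsBlue⇒IsBlue-suc⊎≡ : ∀ c {i} → IsBlue (toℕ c) i → IsBlue (suc (toℕ c)) i ⊎ i ≡ c
    IsBlue⇒IsBlue-suc⊎≡ c (inj₁ leaf) = inj₁ (inj₁ leaf)
    IsBlue⇒IsBlue-suc⊎≡ c {i} (inj₂ c≤i) with toℕ c ℕ.≟ toℕ i
    ... | yes c≡i = inj₂ (Finₚ.toℕ-injective (sym c≡i))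
    ... | no c≢i = inj₁ (inj₂ (ℕₚ.≤∧≢⇒< c≤i c≢i))

    Blue≡Blue-suc∪⁅σc⁆ : ∀ c → Blue (toℕ c) ≡ Blue (suc (toℕ c)) ∪ ⁅ lookup σ c ⁆
    Blue≡Blue-suc∪⁅σc⁆ c = Subsetₚ.⊆-antisym shrink grow
      where
      shrink : Blue (toℕ c) ⊆ Blue (suc (toℕ c)) ∪ ⁅ lookup σ c ⁆
      shrink v∈ with i , blue , refl ← ∈-image⁻ _ (lookup σ) v∈ with IsBlue⇒IsBlue-suc⊎≡ c blue
      ... | inj₁ blue-suc = Subsetₚ.x∈p∪q⁺ (inj₁ (∈Blue blue-suc))
      ... | inj₂ refl = Subsetₚ.x∈p∪q⁺ (inj₂ (Subsetₚ.x∈⁅x⁆ _))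
      grow : Blue (suc (toℕ c)) ∪ ⁅ lookup σ c ⁆ ⊆ Blue (toℕ c)
      grow v∈ with Subsetₚ.x∈p∪q⁻ (Blue (suc (toℕ c))) _ v∈
      ... | inj₁ v∈Blue-suc = image-⊆ _ _ (lookup σ) IsBlue-suc⇒IsBlue v∈Blue-suc
      ... | inj₂ v∈⁅σc⁆ rewrite Subsetₚ.x∈⁅y⁆⇒x≡y _ v∈⁅σc⁆ = ∈Blue (inj₂ ℕₚ.≤-refl)

    Blue≡Blue-suc : ∀ c → IsLeaf c → Blue (toℕ c) ≡ Blue (suc (toℕ c))
    Blue≡Blue-suc c leaf = Subsetₚ.⊆-antisym (image-⊆ _ _ (lookup σ) blue-suc) (image-⊆ _ _ (lookup σ) IsBlue-suc⇒IsBlue)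
      where
      blue-suc : ∀ {i} → IsBlue (toℕ c) i → IsBlue (suc (toℕ c)) i
      blue-suc blue with IsBlue⇒IsBlue-suc⊎≡ c blue
      ... | inj₁ blue-suc = blue-suc
      ... | inj₂ refl = inj₁ leaf

    forcing-step : ∀ c → ¬ IsLeaf c → ZStarStep G (Blue (suc (toℕ c))) (Blue (toℕ c))
    forcing-step c ¬leaf =
      lookup σ ch , lookup σ c , ∈Blue (inj₂ (parent<child σ-earlier c-parent)) , c-white ,
      trans (adj-sym G _ _) c~ch , only-white-neighbour , Z*-condition , Blue≡Blue-suc∪⁅σc⁆ c
      where
      σ-earlier = proj₂ (proj₂ σ-GS)
      child = nonLeaf⇒child σ-earlier 2≤σ c ¬leaf
      ch = proj₁ child
      c-parent = proj₂ child
      c~ch = proj₁ (proj₂ c-parent)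

      same-position : ∀ {i} → toℕ i ≤ toℕ c → toℕ c ≤ toℕ i → lookup σ i ≡ lookup σ c
      same-position i≤c c≤i = cong (lookup σ) (Finₚ.toℕ-injective (ℕₚ.≤-antisym i≤c c≤i))

      c-white : lookup σ c ∉ Blue (suc (toℕ c))
      c-white = ∉Blue λ { (inj₁ leaf) → ¬leaf leaf ; (inj₂ c<c) → ℕₚ.<-irrefl refl c<c }

      only-white-neighbour : ∀ u → Adj G (lookup σ ch) u → u ∉ Blue (suc (toℕ c)) → u ≡ lookup σ c
      only-white-neighbour u ch~u u∉ with i , refl , _ , i≤c ← white-position u∉ with proj₂ (proj₂ c-parent) i
      ... | inj₁ c≤i = same-position (ℕₚ.≤-pred i≤c) c≤i
      ... | inj₂ ¬i~ch = ⊥-elim (¬i~ch (trans (adj-sym G _ _) ch~u))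

      parent-white : 0 < toℕ c → ∃[ u ] (u ∉ Blue (suc (toℕ c)) × Adj G (lookup σ c) u)
      parent-white 0<c = lookup σ r , ∉Blue r-nonBlue , trans (adj-sym G _ _) (proj₁ (proj₂ r-parent))
        where
        parent = parent-exists σ-earlier c 0<c
        r = proj₁ parent
        r-parent = proj₂ parent
        r-nonBlue : ¬ IsBlue (suc (toℕ c)) r
        r-nonBlue (inj₁ (_ , childless)) = childless c r-parent
        r-nonBlue (inj₂ c<r) = ℕₚ.<-asym c<r (parent<child σ-earlier r-parent)

      Z*-condition : (∀ u → u ∉ Blue (suc (toℕ c)) → u ≡ lookup σ c) ⊎
                     (∃[ u ] (u ∉ Blue (suc (toℕ c)) × Adj G (lookup σ c) u))
      Z*-condition with 0 ℕ.<? toℕ c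
      ... | yes 0<c = inj₂ (parent-white 0<c)
      ... | no c≮0 = inj₁ λ u u∉ → let i , σᵢ≡u , _ , i≤c = white-position u∉ in
        trans (sym σᵢ≡u) (same-position (ℕₚ.≤-pred i≤c) (ℕₚ.≤-trans (ℕₚ.≮⇒≥ c≮0) z≤n))

    Blue-zero : Blue 0 ≡ ⊤
    Blue-zero = Subsetₚ.⊆-antisym (λ _ → Subsetₚ.∈⊤) λ {v} _ →
      let i , σᵢ≡v = ∈⇒lookup (σ-covers v) in subst (_∈ Blue 0) σᵢ≡v (∈Blue (inj₂ z≤n))

    ∣Blue-length∣≤numLeaves : ∣ Blue (length σ) ∣ ≤ numLeaves G σ
    ∣Blue-length∣≤numLeaves = ℕₚ.≤-trans (∣image∣≤countᵇ _ (lookup σ)) (countᵇ-mono _ _ only-leaves)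
      where
      only-leaves : ∀ i → isLeafᵇ G σ i ∨ does (length σ ≤? toℕ i) ≡ true → isLeafᵇ G σ i ≡ true
      only-leaves i blue rewrite dec-false (length σ ≤? toℕ i) (ℕₚ.<⇒≱ (Finₚ.toℕ<n i)) =
        trans (sym (Boolₚ.∨-identityʳ _)) blue

    forcing-past : ∀ {q} (c : Position) → toℕ c ≡ q →
      Star (ZStarStep G) (Blue q) ⊤ → Star (ZStarStep G) (Blue (suc q)) ⊤
    forcing-past c refl forcing with isLeaf? c
    ... | yes leaf = subst (λ B → Star (ZStarStep G) B ⊤) (Blue≡Blue-suc c leaf) forcing
    ... | no ¬leaf = forcing-step c ¬leaf ◅ forcing

    forcing : ∀ p → p ≤ length σ → Star (ZStarStep G) (Blue p) ⊤
    forcing zero _ = subst (λ B → Star (ZStarStep G) B ⊤) (sym Blue-zero) ε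
    forcing (suc q) q<σ = forcing-past (fromℕ< q<σ) (Finₚ.toℕ-fromℕ< q<σ) (forcing q (ℕₚ.<⇒≤ q<σ))

  GSOrdering⇒ZStarForcingSet : 2 ≤ n → ∀ {σ} → IsGSOrdering G σ →
    ∃[ S ] (IsZStarForcingSet G S × ∣ S ∣ ≤ numLeaves G σ)
  GSOrdering⇒ZStarForcingSet 2≤n {σ} σ-GS = Blue (length σ) , forcing (length σ) ℕₚ.≤-refl , ∣Blue-length∣≤numLeaves
    where open ForcingSetFromOrdering σ-GS 2≤n

  prefix⇒GSOrderingExtending : Connected G → 0 < n → ∀ {xs} → Unique xs → AdjacentToEarlier xs → GSOrderingExtending xs
  prefix⇒GSOrderingExtending conn 0<n {[]} _ _ =
    GSOrderingExtending-++⁻ [] [ fromℕ< 0<n ] (extendToGSOrdering conn (All.[] ∷ []) (λ { fzero () }) (here refl))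
  prefix⇒GSOrderingExtending conn 0<n {x ∷ xs} unique earlier = extendToGSOrdering conn unique earlier (here refl)

  -- The vertices outside B, listed in the reverse of the order in which some Z*-forcing process from B colours them.
  record ReversedForcingOrder (B : Subset n) : Set where
    field
      order : List (Fin n)
      unique : Unique order
      white : All (_∉ B) order
      covers-white : ∀ u → u ∉ B → u ∈ₗ order
      card : n ≤ ∣ B ∣ + length order
      adjacentToEarlier : AdjacentToEarlier order
      privateNeighbours : PrivateNeighbours order

  ReversedForcingOrder-⊤ : ReversedForcingOrder ⊤
  ReversedForcingOrder-⊤ = record
    { order = []
    ; unique = []
    ; white = All.[]
    ; covers-white = λ u u∉⊤ → ⊥-elim (u∉⊤ Subsetₚ.∈⊤)
    ; card = ℕₚ.≤-reflexive (sym (trans (ℕₚ.+-identityʳ _) (Subsetₚ.∣⊤∣≡n n)))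
    ; adjacentToEarlier = λ ()
    ; privateNeighbours = λ ()
    }

  -- The vertex v forcing w is a private neighbour of w: v is blue, and w is its only white neighbour.
  ReversedForcingOrder-step : ∀ {B B′} → ZStarStep G B B′ → ReversedForcingOrder B′ → ReversedForcingOrder B
  ReversedForcingOrder-step {B} (v , w , v∈B , w∉B , v~w , w-only , Z*-condition , refl) R = record
    { order = order ++ [ w ]
    ; unique = Unique-snoc unique λ w∈order → All.lookup white w∈order w∈B′
    ; white = Allₚ.++⁺ (All.map (_∘ ∈B⇒∈B′) white) (w∉B All.∷ All.[])
    ; covers-white = covers-white′
    ; card = ℕₚ.≤-trans card (ℕₚ.≤-trans (ℕₚ.+-monoˡ-≤ _ (∣p∪q∣≤∣p∣+∣q∣ B ⁅ w ⁆)) (ℕₚ.≤-reflexive card-eq))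
    ; adjacentToEarlier = AdjacentToEarlier-snoc adjacentToEarlier (w-adjacent Z*-condition)
    ; privateNeighbours = PrivateNeighbours-snoc privateNeighbours (trans (adj-sym G w v) v~w) (All.tabulate v-private)
    }
    where
    open ReversedForcingOrder R
    B′ = B ∪ ⁅ w ⁆

    ∈B⇒∈B′ : ∀ {x} → x ∈ B → x ∈ B′
    ∈B⇒∈B′ x∈B = Subsetₚ.x∈p∪q⁺ (inj₁ x∈B)

    w∈B′ : w ∈ B′
    w∈B′ = Subsetₚ.x∈p∪q⁺ (inj₂ (Subsetₚ.x∈⁅x⁆ w))

    ∉B⇒∉B′ : ∀ {x} → x ∉ B → x ≢ w → x ∉ B′
    ∉B⇒∉B′ x∉B x≢w x∈B′ with Subsetₚ.x∈p∪q⁻ B ⁅ w ⁆ x∈B′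
    ... | inj₁ x∈B = x∉B x∈B
    ... | inj₂ x∈⁅w⁆ = x≢w (Subsetₚ.x∈⁅y⁆⇒x≡y w x∈⁅w⁆)

    card-eq : ∣ B ∣ + ∣ ⁅ w ⁆ ∣ + length order ≡ ∣ B ∣ + length (order ++ [ w ])
    card-eq = begin
      ∣ B ∣ + ∣ ⁅ w ⁆ ∣ + length order ≡⟨ cong (λ k → ∣ B ∣ + k + length order) (Subsetₚ.∣⁅x⁆∣≡1 w) ⟩
      ∣ B ∣ + 1 + length order         ≡⟨ ℕₚ.+-assoc ∣ B ∣ 1 (length order) ⟩
      ∣ B ∣ + suc (length order)       ≡⟨ cong (λ k → ∣ B ∣ + k) (sym (length-snoc order w)) ⟩
      ∣ B ∣ + length (order ++ [ w ])  ∎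
      where open ≡-Reasoning

    covers-white′ : ∀ u → u ∉ B → u ∈ₗ order ++ [ w ]
    covers-white′ u u∉B with u Finₚ.≟ w
    ... | yes refl = Membershipₚ.∈-++⁺ʳ order (here refl)
    ... | no u≢w = Membershipₚ.∈-++⁺ˡ (covers-white u (∉B⇒∉B′ u∉B u≢w))

    w-adjacent : ((∀ u → u ∉ B → u ≡ w) ⊎ ∃[ u ] (u ∉ B × Adj G w u)) → 0 < length order → Any (Adj G w) order
    w-adjacent (inj₁ w-last) 0<order = ⊥-elim (x∉B′ (subst (_∈ B′) (sym (w-last x (x∉B′ ∘ ∈B⇒∈B′))) w∈B′))
      where
      x = lookup order (fromℕ< 0<order)
      x∉B′ = All.lookup white (Membershipₚ.∈-lookup (fromℕ< 0<order))
    w-adjacent (inj₂ (u , u∉B , w~u)) _ = Any.map (λ { refl → w~u }) (covers-white u (∉B⇒∉B′ u∉B u≢w))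
      where
      u≢w : u ≢ w
      u≢w refl with () ← trans (sym (adj-irrefl G u)) w~u

    v-private : ∀ {x} → x ∈ₗ order → (v ≢ x) × ¬ Adj G x v
    v-private x∈order = (λ { refl → x∉B′ (∈B⇒∈B′ v∈B) }) ,
      λ x~v → x∉B′ (subst (_∈ B′) (sym (w-only _ (trans (adj-sym G v _) x~v) (x∉B′ ∘ ∈B⇒∈B′))) w∈B′)
      where
      x∉B′ = All.lookup white x∈order

  reversedForcingOrder : ∀ {B} → Star (ZStarStep G) B ⊤ → ReversedForcingOrder B
  reversedForcingOrder ε = ReversedForcingOrder-⊤
  reversedForcingOrder (step ◅ steps) = ReversedForcingOrder-step step (reversedForcingOrder steps)

  ZStarForcingSet⇒GenericZSeq : Connected G → 2 ≤ n → ∀ {S} → IsZStarForcingSet G S →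
    ∃[ vs ] (IsGenericZSeq G vs × n ≤ ∣ S ∣ + length vs)
  ZStarForcingSet⇒GenericZSeq conn 2≤n forcing =
    order , (prefix⇒GSOrderingExtending conn (ℕₚ.<-trans (s≤s z≤n) 2≤n) unique adjacentToEarlier , privateNeighbours) , card
    where open ReversedForcingOrder (reversedForcingOrder forcing)

  privateNeighbour-not-first : ∀ vs ρ i {w} → Adj G (lookup vs i) w →
    (∀ j → toℕ j < toℕ i → (w ≢ lookup vs j) × ¬ Adj G (lookup vs j) w) → ∀ d → lookup (vs ++ ρ) d ≡ w → 0 < toℕ d
  privateNeighbour-not-first (x ∷ _) ρ _ _ _ (fsuc d) _ = s≤s z≤n
  privateNeighbour-not-first (x ∷ _) ρ fzero x~w _ fzero refl with () ← trans (sym (adj-irrefl G x)) x~w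
  privateNeighbour-not-first (x ∷ _) ρ (fsuc i) _ w-private fzero refl = ⊥-elim (proj₁ (w-private fzero (s≤s z≤n)) refl)

  module PrefixOfGSOrdering {vs ρ} (σ-covers : ∀ v → v ∈ₗ vs ++ ρ) (private-vs : PrivateNeighbours vs) where

    open FTree (vs ++ ρ)

    prefix-parent : ∀ i → ∃[ d ] IsParent (inject++ vs ρ i) d
    prefix-parent i with w , i~w , w-private ← private-vs i with d , σd≡w ← ∈⇒lookup (σ-covers w) =
      d , privateNeighbour-not-first vs ρ i i~w w-private d σd≡w ,
      subst₂ (Adj G) (sym (lookup-inject++ vs ρ i)) (sym σd≡w) i~w , leftmost
      where
      earlier-not-adjacent : ∀ k → toℕ k < toℕ i → ¬ Adj G (lookup (vs ++ ρ) k) w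
      earlier-not-adjacent k k<i with j , refl ← inject++-< vs ρ k (ℕₚ.<-trans k<i (Finₚ.toℕ<n i))
        rewrite lookup-inject++ vs ρ j = proj₂ (w-private j (subst (_< toℕ i) (toℕ-inject++ vs ρ j) k<i))

      leftmost : ∀ k → toℕ (inject++ vs ρ i) ≤ toℕ k ⊎ ¬ Adj G (lookup (vs ++ ρ) k) (lookup (vs ++ ρ) d)
      leftmost k with toℕ (inject++ vs ρ i) ≤? toℕ k
      ... | yes c≤k = inj₁ c≤k
      ... | no c≰k = inj₂ (subst (¬_ ∘ Adj G (lookup (vs ++ ρ) k)) (sym σd≡w)
                            (earlier-not-adjacent k (subst (toℕ k <_) (toℕ-inject++ vs ρ i) (ℕₚ.≰⇒> c≰k))))

    prefix-nonLeaf : ∀ c → toℕ c < length vs → isLeafᵇ G (vs ++ ρ) c ≡ false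
    prefix-nonLeaf c c<vs with i , refl ← inject++-< vs ρ c c<vs with d , parent ← prefix-parent i =
      dec-false (isLeaf? _) λ (_ , childless) → childless d parent

  GenericZSeq⇒GSOrdering : ∀ {vs} → IsGenericZSeq G vs → ∃[ σ ] (IsGSOrdering G σ × numLeaves G σ + length vs ≤ n)
  GenericZSeq⇒GSOrdering {vs} ((_ , σ-GS@(σ-unique , σ-covers , _) , ρ , refl) , private-vs) =
    vs ++ ρ , σ-GS ,
    ℕₚ.≤-trans (countᵇ+k≤ (isLeafᵇ G (vs ++ ρ)) (length vs) (Listₚ.length-++-≤ˡ vs) prefix-nonLeaf)
               (Unique⇒length≤ σ-unique)
    where open PrefixOfGSOrdering {vs} {ρ} σ-covers private-vs

theorem3p10 : ∀ {n : ℕ} (G : Graph n) → Connected G → 2 ≤ n → (k : ℤ) →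
    ((∃[ σ ] (IsGSOrdering G σ × + numLeaves G σ ≤ℤ k))
       ⇔ (∃[ S ] (IsZStarForcingSet G S × + ∣ S ∣ ≤ℤ k)))
    × ((∃[ S ] (IsZStarForcingSet G S × + ∣ S ∣ ≤ℤ k))
       ⇔ (∃[ vs ] (IsGenericZSeq G vs × (+ n) - k ≤ℤ + length vs)))
theorem3p10 {n} G conn 2≤n k = mk⇔ 1⇒2 (3⇒1 ∘ 2⇒3) , mk⇔ 2⇒3 (1⇒2 ∘ 3⇒1)
  where
  open ℤₚ.≤-Reasoning

  1⇒2 : ∃[ σ ] (IsGSOrdering G σ × + numLeaves G σ ≤ℤ k) → ∃[ S ] (IsZStarForcingSet G S × + ∣ S ∣ ≤ℤ k)
  1⇒2 (σ , σ-GS , ℓ≤k) with S , forcing , ∣S∣≤ℓ ← GSOrdering⇒ZStarForcingSet G 2≤n σ-GS =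
    S , forcing , ℤₚ.≤-trans (+≤+ ∣S∣≤ℓ) ℓ≤k

  2⇒3 : ∃[ S ] (IsZStarForcingSet G S × + ∣ S ∣ ≤ℤ k) → ∃[ vs ] (IsGenericZSeq G vs × (+ n) - k ≤ℤ + length vs)
  2⇒3 (S , forcing , ∣S∣≤k) with vs , generic , n≤S+vs ← ZStarForcingSet⇒GenericZSeq G conn 2≤n forcing =
    vs , generic , i≤k+j⇒i-k≤j (+ n) (+ length vs) k (begin
      + n                       ≤⟨ +≤+ n≤S+vs ⟩
      + (∣ S ∣ + length vs)     ≡⟨ ℤₚ.pos-+ ∣ S ∣ (length vs) ⟩
      + ∣ S ∣ ℤ.+ + length vs   ≤⟨ ℤₚ.+-monoˡ-≤ (+ length vs) ∣S∣≤k ⟩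
      k ℤ.+ + length vs         ∎)

  3⇒1 : ∃[ vs ] (IsGenericZSeq G vs × (+ n) - k ≤ℤ + length vs) → ∃[ σ ] (IsGSOrdering G σ × + numLeaves G σ ≤ℤ k)
  3⇒1 (vs , generic , n-k≤vs) with σ , σ-GS , ℓ+vs≤n ← GenericZSeq⇒GSOrdering G generic =
    σ , σ-GS , +-cancelʳ-≤ (+ numLeaves G σ) (+ length vs) k (begin
      + numLeaves G σ ℤ.+ + length vs ≡⟨ ℤₚ.pos-+ (numLeaves G σ) (length vs) ⟨
      + (numLeaves G σ + length vs)   ≤⟨ +≤+ ℓ+vs≤n ⟩
      + n                             ≤⟨ i-k≤j⇒i≤k+j (+ n) (+ length vs) k n-k≤vs ⟩
      k ℤ.+ + length vs               ∎)
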